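{- Let $a,b$ be coprime positive integers. Every equivalence class of $\approx$ in $\mathbb{Z}^b$ contains exactly one superstable configuration. In particular, every chip configuration $D\ge 0$ has a unique superstabilization.
   Context: Write $[b]=\{1,\dots,b\}$. A chip configuration is $D:[b]\to\mathbb{Z}$, identified with a vector in $\mathbb{Z}^b$; $D\ge0$ means all entries nonnegative. For $S\subseteq[b]$ with $|S|=s$, the cluster-fire move $\phi_S$ subtracts $1+\lfloor (b-s)a/b\rfloor$ from $D(i)$ for $i\in S$ and adds $\lfloor sa/b\rfloor$ to $D(j)$ for $j\in[b]\setminus S$ ($\phi_\varnothing$ the identity); the borrow move is $\beta_S=\phi_S^{ -1}$. For $D\ge 0$, $\phi_S$ is legal if $\phi_S(D)\ge0$. $D\ge 0$ is superstable if no $\phi_S$ with $S\ne\varnothing$ is legal on $D$. A superstabilization of $D\ge0$ is a superstable configuration obtained from $D$ by a finite sequence of cluster-fire moves with nonempty sets, each legal on the configuration to which it is applied. $D\approx D'$ means $D$ can be converted to $D'$ by a finite sequence of (not necessarily legal) cluster-fire and borrow moves. -}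

module Defs where

open import Data.Nat as ℕ using (ℕ; zero; suc; _∸_; NonZero)
open import Data.Nat.DivMod using (_/_)
open import Data.Integer as ℤ using (ℤ; +_; _+_; _-_; _≤_)
open import Data.Bool using (Bool; true; false; if_then_else_)
open import Data.Fin using (Fin)
open import Data.Fin.Subset using (Subset; ∣_∣; Nonempty)
open import Data.Vec using (Vec; lookup; tabulate)
open import Data.Product using (Σ; ∃; _×_)
open import Data.Sum using (_⊎_)
open import Relation.Nullary using (¬_)
open import Relation.Binary.PropositionalEquality using (_≡_)
open import Relation.Binary.Construct.Closure.ReflexiveTransitive using (Star)

-- A chip configuration D : [b] → ℤ, as a vector in ℤ^b (index Fin b ≅ [b]).
Config : ℕ → Set
Config b = Vec ℤ b

NonNeg : ∀ {b} → Config b → Set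
NonNeg {b} D = ∀ (i : Fin b) → + 0 ≤ lookup D i

module _ (a b : ℕ) .{{_ : NonZero b}} where

  loss : Subset b → ℕ
  loss S = suc (((b ∸ ∣ S ∣) ℕ.* a) / b)

  gain : Subset b → ℕ
  gain S = (∣ S ∣ ℕ.* a) / b

  fire : Subset b → Config b → Config b
  fire S D = tabulate λ i →
    if lookup S i then lookup D i - + loss S else lookup D i + + gain S

  borrow : Subset b → Config b → Config b
  borrow S D = tabulate λ i →
    if lookup S i then lookup D i + + loss S else lookup D i - + gain S

  -- one (not necessarily legal) cluster-fire or borrow move
  Move : Config b → Config b → Set
  Move D D' = ∃ λ (S : Subset b) → (D' ≡ fire S D) ⊎ (D' ≡ borrow S D)

  _≈_ : Config b → Config b → Set
  _≈_ = Star Move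

  Superstable : Config b → Set
  Superstable D = NonNeg D × (∀ (S : Subset b) → Nonempty S → ¬ NonNeg (fire S D))

  LegalFire : Config b → Config b → Set
  LegalFire D D' = NonNeg D × ∃ λ (S : Subset b) →
    Nonempty S × NonNeg (fire S D) × (D' ≡ fire S D)

  Superstabilization : Config b → Config b → Set
  Superstabilization D D' = Star LegalFire D D' × Superstable D'

module Submission where

-- Every move adds the same constant to all entries modulo a: firing everything subtracts 1, and
-- firing a proper nonempty cluster S adds gain S outside S and subtracts loss S = a - gain S
-- inside it, since coprimality gives loss S + gain S = a. So ≈-equivalent configurations differ
-- by a constant modulo a.
-- Firing a singleton costs at most a, so superstable entries lie in [0, a). If superstable E, E'
-- differ by c ∈ (0, a) modulo a, let W be the set of j with E j + c ≥ a: if c ≤ gain W then W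
-- can be fired legally on E, and otherwise ∁ W (with loss (∁ W) = 1 + gain W ≤ c) on E'.
-- For existence, borrow on all vertices until D ≥ 0 and then fire legal clusters while possible:
-- a legal firing of S changes the total by (b - s) gain S - s loss S < 0.

open import Defs
open import Data.Bool.Base using (true; false; if_then_else_)
open import Data.Empty using (⊥; ⊥-elim)
open import Data.Fin.Base using (Fin; zero; suc)
open import Data.Fin.Properties using (all?)
open import Data.Fin.Subset using (Subset; ∣_∣; ∁; ⊤; ⁅_⁆; Nonempty; _∈_)
open import Data.Fin.Subset.Properties
  using ( ∣p∣≤n; ∣∁p∣≡n∸∣p∣; ∣⊤∣≡n; ∣⊥∣≡0; ∣p∣≡n⇒p≡⊤; x∈⁅x⁆; x∈⁅y⁆⇒x≡y; x∈∁p⇒x∉p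
        ; x∈p⇒∣p-x∣<∣p∣; Empty-unique; nonempty?; anySubset?)
open import Data.Integer.Base as ℤ using (ℤ; +_; -[1+_]; +[1+_]; +≤+; +<+; -1ℤ)
import Data.Integer.Properties as ℤ
open import Data.Integer.DivMod using (_%ℕ_; _/ℕ_; a≡a%ℕn+[a/ℕn]*n; n%ℕd<d)
open import Data.Nat.Base as ℕ using (ℕ; zero; suc; _∸_; NonZero; z≤n; s≤s)
import Data.Nat.Properties as ℕ
open import Data.Nat.Coprimality as Coprime using (Coprime; coprime-divisor)
open import Data.Nat.DivMod using (_/_; _%_; m≡m%n+[m/n]*n; m%n<n; m/n*n≤m; m<n*o⇒m/o<n; 0/n≡0)
open import Data.Nat.Divisibility using (_∣_; ∣⇒≤; m%n≡0⇒n∣m)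
open import Data.Nat.Induction using (<-wellFounded)
open import Data.Product.Base using (∃; _×_; _,_; proj₁)
open import Data.Sum.Base using (_⊎_; inj₁; inj₂; [_,_]′)
open import Data.Vec.Base using (Vec; []; _∷_; lookup; tabulate)
open import Data.Vec.Properties
  using (lookup∘tabulate; tabulate∘lookup; tabulate-cong; lookup-replicate; lookup⇒[]=; []=⇒lookup)
open import Function.Base using (_∘_)
open import Induction.WellFounded using (Acc; acc)
open import Relation.Binary.Construct.Closure.ReflexiveTransitive as Star using (Star; ε; _◅_; _◅◅_)
open import Relation.Binary.PropositionalEquality
open import Relation.Nullary using (¬_; Dec; yes; no; does)
open import Relation.Nullary.Decidable using (dec-true; _×-dec_)
open import Relation.Unary using (Pred; Decidable)

module _ where
  open import Data.Nat.Base using (_+_; _*_; _≤_; _<_; s≤s⁻¹; >-nonZero)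
  open import Data.Nat.Properties
  open import Data.Nat.Tactic.RingSolver using (solve-∀)

  m<[1+m/n]*n : ∀ m n .{{_ : NonZero n}} → m < suc (m / n) * n
  m<[1+m/n]*n m n = begin-strict
    m                   ≡⟨ m≡m%n+[m/n]*n m n ⟩
    m % n + (m / n) * n <⟨ +-monoˡ-< ((m / n) * n) (m%n<n m n) ⟩
    suc (m / n) * n     ∎
    where open ≤-Reasoning

  -- The two remainders add up to some r with 0 < r < 2o, which pins k strictly between q and q + 2.
  m+n≡k*o⇒1+m/o+n/o≡k : ∀ {m n o k} .{{_ : NonZero o}} →
    ¬ o ∣ m → m + n ≡ k * o → suc (m / o + n / o) ≡ k
  m+n≡k*o⇒1+m/o+n/o≡k {m} {n} {o} {k} o∤m m+n≡k*o =
    ≤-antisym (*-cancelʳ-< o _ _ lower) (s≤s⁻¹ (*-cancelʳ-< o _ _ upper))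
    where
    q r : ℕ
    q = m / o + n / o
    r = m % o + n % o

    k*o≡r+q*o : k * o ≡ r + q * o
    k*o≡r+q*o = begin
      k * o                                     ≡⟨ m+n≡k*o ⟨
      m + n                                     ≡⟨ cong₂ _+_ (m≡m%n+[m/n]*n m o) (m≡m%n+[m/n]*n n o) ⟩
      (m % o + m / o * o) + (n % o + n / o * o) ≡⟨ regroup (m % o) (m / o) (n % o) (n / o) o ⟩
      r + q * o                                 ∎
      where
      open ≡-Reasoning
      regroup : ∀ x y z w u → (x + y * u) + (z + w * u) ≡ (x + z) + (y + w) * u
      regroup = solve-∀

    0<r : 0 < r
    0<r = <-≤-trans (n≢0⇒n>0 λ m%o≡0 → o∤m (m%n≡0⇒n∣m m o m%o≡0)) (m≤m+n (m % o) (n % o))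

    lower : q * o < k * o
    lower = subst (q * o <_) (sym k*o≡r+q*o) (m<n+m (q * o) 0<r)

    upper : k * o < suc (suc q) * o
    upper = begin-strict
      k * o           ≡⟨ k*o≡r+q*o ⟩
      r + q * o       <⟨ +-monoˡ-< (q * o) (+-mono-< (m%n<n m o) (m%n<n n o)) ⟩
      (o + o) + q * o ≡⟨ +-assoc o o (q * o) ⟩
      suc (suc q) * o ∎
      where open ≤-Reasoning

  n*[m*a/b]<m*[1+n*a/b] : ∀ m n a b .{{_ : NonZero b}} → 0 < m →
    n * (m * a / b) < m * suc (n * a / b)
  n*[m*a/b]<m*[1+n*a/b] m n a b 0<m = *-cancelˡ-< b _ _ (begin-strict
    b * (n * (m * a / b))     ≡⟨ *-comm b _ ⟩
    n * (m * a / b) * b       ≡⟨ *-assoc n _ b ⟩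
    n * (m * a / b * b)       ≤⟨ *-monoʳ-≤ n (m/n*n≤m (m * a) b) ⟩
    n * (m * a)               ≡⟨ swap n m a ⟩
    m * (n * a)               <⟨ *-monoʳ-< m (m<[1+m/n]*n (n * a) b) ⟩
    m * (suc (n * a / b) * b) ≡⟨ *-assoc m _ b ⟨
    m * suc (n * a / b) * b   ≡⟨ *-comm _ b ⟩
    b * (m * suc (n * a / b)) ∎)
    where
    open ≤-Reasoning
    instance _ = >-nonZero 0<m
    swap : ∀ x y z → x * (y * z) ≡ y * (x * z)
    swap = solve-∀

module _ {n} {p : Subset n} where

  Nonempty⇒0<∣p∣ : Nonempty p → 0 ℕ.< ∣ p ∣
  Nonempty⇒0<∣p∣ (x , x∈p) = ℕ.≤-<-trans z≤n (x∈p⇒∣p-x∣<∣p∣ x∈p)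

  0<∣p∣⇒Nonempty : 0 ℕ.< ∣ p ∣ → Nonempty p
  0<∣p∣⇒Nonempty 0<∣p∣ with nonempty? p
  ... | yes p≢∅ = p≢∅
  ... | no  p≡∅ = ⊥-elim (ℕ.<-irrefl (sym (∣⊥∣≡0 n))
                    (subst (λ q → 0 ℕ.< ∣ q ∣) (Empty-unique p≡∅) 0<∣p∣))

module _ {n ℓ} {P : Pred (Fin n) ℓ} (P? : Decidable P) where

  select : Subset n
  select = tabulate (does ∘ P?)

  ∈-select⁺ : ∀ {x} → P x → x ∈ select
  ∈-select⁺ {x} px = lookup⇒[]= x select (trans (lookup∘tabulate (does ∘ P?) x) (dec-true (P? x) px))

  ∈-select⁻ : ∀ {x} → x ∈ select → P x
  ∈-select⁻ {x} x∈select with P? x | trans (sym (lookup∘tabulate (does ∘ P?) x)) ([]=⇒lookup x∈select)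
  ... | yes px | _  = px
  ... | no  _  | ()

  ∈-∁select⁻ : ∀ {x} → x ∈ ∁ select → ¬ P x
  ∈-∁select⁻ x∈∁select px = x∈∁p⇒x∉p x∈∁select (∈-select⁺ px)

lookup-ext : ∀ {n} {A : Set} {xs ys : Vec A n} → (∀ i → lookup xs i ≡ lookup ys i) → xs ≡ ys
lookup-ext {xs = xs} {ys} eq = begin
  xs                   ≡⟨ tabulate∘lookup xs ⟨
  tabulate (lookup xs) ≡⟨ tabulate-cong eq ⟩
  tabulate (lookup ys) ≡⟨ tabulate∘lookup ys ⟩
  ys                   ∎
  where open ≡-Reasoning

module _ where
  open import Data.Integer.Base using (_+_; _-_; _*_; -_; _≤_; _<_)
  open import Data.Integer.Tactic.RingSolver using (solve-∀)

  infix 4 _≡_mod_ _≃_mod_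

  _≡_mod_ : ℤ → ℤ → ℕ → Set
  _≡_mod_ x y a = ∃ λ m → x ≡ y + m * + a

  ≡⇒≡mod : ∀ {a x y} → x ≡ y → x ≡ y mod a
  ≡⇒≡mod {a} {y = y} refl = + 0 , add-zero y (+ a)
    where
    add-zero : ∀ y A → y ≡ y + + 0 * A
    add-zero = solve-∀

  +x≡+y+[1+j]*+a⇒a≤x : ∀ {x y} j a → + x ≡ + y + +[1+ j ] * + a → a ℕ.≤ x
  +x≡+y+[1+j]*+a⇒a≤x {x} {y} j a eq =
    subst (a ℕ.≤_) (sym x≡y+[1+j]*a) (ℕ.≤-trans (ℕ.m≤m+n a (j ℕ.* a)) (ℕ.m≤n+m _ y))
    where
    x≡y+[1+j]*a : x ≡ y ℕ.+ suc j ℕ.* a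
    x≡y+[1+j]*a = ℤ.+-injective (trans eq (cong (_+_ (+ y)) (sym (ℤ.pos-* (suc j) a))))

  +≡+mod⇒≡ : ∀ {a x y} → x ℕ.< a → y ℕ.< a → + x ≡ + y mod a → x ≡ y
  +≡+mod⇒≡ {y = y} _ _ (+ zero , x≡y+0) = trans (ℤ.+-injective x≡y+0) (ℕ.+-identityʳ y)
  +≡+mod⇒≡ {a} x<a _ (+[1+ j ] , eq) = ⊥-elim (ℕ.<⇒≱ x<a (+x≡+y+[1+j]*+a⇒a≤x j a eq))
  +≡+mod⇒≡ {a} {x} {y} _ y<a (-[1+ j ] , eq) = ⊥-elim (ℕ.<⇒≱ y<a (+x≡+y+[1+j]*+a⇒a≤x j a y≡x+[1+j]*a))
    where
    cancel : ∀ y n A → y + (- n) * A + n * A ≡ y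
    cancel = solve-∀
    y≡x+[1+j]*a : + y ≡ + x + +[1+ j ] * + a
    y≡x+[1+j]*a = sym (trans (cong (λ z → z + +[1+ j ] * + a) eq) (cancel (+ y) +[1+ j ] (+ a)))

  nonneg-≡mod⇒≡ : ∀ {a x y} → + 0 ≤ x → x < + a → + 0 ≤ y → y < + a → x ≡ y mod a → x ≡ y
  nonneg-≡mod⇒≡ (+≤+ _) (+<+ x<a) (+≤+ _) (+<+ y<a) x≡y = cong +_ (+≡+mod⇒≡ x<a y<a x≡y)

  +-cancelʳ-≤ : ∀ {x y} z → x + z ≤ y + z → x ≤ y
  +-cancelʳ-≤ {x} {y} z x+z≤y+z = subst₂ _≤_ (cancel x z) (cancel y z) (ℤ.+-monoˡ-≤ (- z) x+z≤y+z)
    where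
    cancel : ∀ x z → x + z + - z ≡ x
    cancel = solve-∀

  record _≃_mod_ {n} (D D' : Vec ℤ n) (a : ℕ) : Set where
    constructor _,_
    field
      shift     : ℤ
      congruent : ∀ i → lookup D' i ≡ lookup D i + shift mod a

  module _ {n a : ℕ} where

    ≃-refl : {D : Vec ℤ n} → D ≃ D mod a
    ≃-refl {D} = + 0 , λ i → + 0 , add-zeros (lookup D i) (+ a)
      where
      add-zeros : ∀ x A → x ≡ x + + 0 + + 0 * A
      add-zeros = solve-∀

    ≃-sym : {D D' : Vec ℤ n} → D ≃ D' mod a → D' ≃ D mod a
    ≃-sym {D} {D'} (k , D'≡D+k) = - k , λ i → let (m , eq) = D'≡D+k i in
      - m , subst (λ x → lookup D i ≡ x + - k + - m * + a) (sym eq) (undo (lookup D i) k m (+ a))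
      where
      undo : ∀ x k m A → x ≡ x + k + m * A + - k + - m * A
      undo = solve-∀

    ≃-trans : {D D' D'' : Vec ℤ n} → D ≃ D' mod a → D' ≃ D'' mod a → D ≃ D'' mod a
    ≃-trans {D} (k , D'≡D+k) (l , D''≡D'+l) = k + l , λ i →
      let (m , eq) = D'≡D+k i ; (m' , eq') = D''≡D'+l i in
      m + m' , trans eq' (trans (cong (λ x → x + l + m' * + a) eq) (compose (lookup D i) k l m m' (+ a)))
      where
      compose : ∀ x k l m m' A → x + k + m * A + l + m' * A ≡ x + (k + l) + (m + m') * A
      compose = solve-∀

    ≃⇒shift<a : .{{_ : NonZero a}} {D D' : Vec ℤ n} → D ≃ D' mod a →
      ∃ λ c → c ℕ.< a × ∀ i → lookup D' i ≡ lookup D i + + c mod a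
    ≃⇒shift<a {D} (k , D'≡D+k) = k %ℕ a , n%ℕd<d k a , λ i → let (m , eq) = D'≡D+k i in
      k /ℕ a + m , trans eq (trans (cong (λ x → lookup D i + x + m * + a) (a≡a%ℕn+[a/ℕn]*n k a))
        (regroup (lookup D i) (+ (k %ℕ a)) (k /ℕ a) m (+ a)))
      where
      regroup : ∀ x c q m A → x + (c + q * A) + m * A ≡ x + c + (q + m) * A
      regroup = solve-∀

  deg : ∀ {n} → Vec ℤ n → ℤ
  deg []       = + 0
  deg (x ∷ xs) = x + deg xs

  deg-nonneg : ∀ {n} (D : Vec ℤ n) → NonNeg D → + 0 ≤ deg D
  deg-nonneg []      _   = +≤+ z≤n
  deg-nonneg (x ∷ D) D≥0 = ℤ.+-mono-≤ (D≥0 zero) (deg-nonneg D (D≥0 ∘ suc))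

  transfer : ∀ {n} → Subset n → ℤ → ℤ → Vec ℤ n → Vec ℤ n
  transfer S L G D = tabulate λ i → if lookup S i then lookup D i - L else lookup D i + G

  deg-transfer : ∀ {n} (S : Subset n) L G (D : Vec ℤ n) →
    deg (transfer S L G D) + + ∣ S ∣ * L ≡ deg D + + ∣ ∁ S ∣ * G
  deg-transfer []          L G []      = refl
  deg-transfer (true ∷ S)  L G (x ∷ D) = begin
    x - L + deg (transfer S L G D) + + suc ∣ S ∣ * L
      ≡⟨ cong (λ t → x - L + deg (transfer S L G D) + t * L) (ℤ.pos-+ 1 ∣ S ∣) ⟩
    x - L + deg (transfer S L G D) + (+ 1 + + ∣ S ∣) * L
      ≡⟨ regroup x L (deg (transfer S L G D)) (+ ∣ S ∣) ⟩
    x + (deg (transfer S L G D) + + ∣ S ∣ * L)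
      ≡⟨ cong (_+_ x) (deg-transfer S L G D) ⟩
    x + (deg D + + ∣ ∁ S ∣ * G)
      ≡⟨ ℤ.+-assoc x (deg D) _ ⟨
    x + deg D + + ∣ ∁ S ∣ * G ∎
    where
    open ≡-Reasoning
    regroup : ∀ x L T s → x - L + T + (+ 1 + s) * L ≡ x + (T + s * L)
    regroup = solve-∀
  deg-transfer (false ∷ S) L G (x ∷ D) = begin
    x + G + deg (transfer S L G D) + + ∣ S ∣ * L
      ≡⟨ regroup x G (deg (transfer S L G D)) (+ ∣ S ∣ * L) ⟩
    x + (deg (transfer S L G D) + + ∣ S ∣ * L) + G
      ≡⟨ cong (λ t → x + t + G) (deg-transfer S L G D) ⟩
    x + (deg D + + ∣ ∁ S ∣ * G) + G
      ≡⟨ ungroup x (deg D) (+ ∣ ∁ S ∣) G ⟩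
    x + deg D + (+ 1 + + ∣ ∁ S ∣) * G
      ≡⟨ cong (λ t → x + deg D + t * G) (ℤ.pos-+ 1 ∣ ∁ S ∣) ⟨
    x + deg D + + suc ∣ ∁ S ∣ * G ∎
    where
    open ≡-Reasoning
    regroup : ∀ x G T U → x + G + T + U ≡ x + (T + U) + G
    regroup = solve-∀
    ungroup : ∀ x T c G → x + (T + c * G) + G ≡ x + T + (+ 1 + c) * G
    ungroup = solve-∀

  nonneg-offset : ∀ {n} (D : Vec ℤ n) → ∃ λ k → ∀ i → + 0 ≤ lookup D i + + k
  nonneg-offset []      = 0 , λ ()
  nonneg-offset (x ∷ D) with nonneg-offset D
  ... | k , D+k≥0 = ℤ.∣ x ∣ ℕ.+ k , λ
    { zero    → ℤ.≤-trans (0≤x+∣x∣ x) (ℤ.+-monoʳ-≤ x (+≤+ (ℕ.m≤m+n ℤ.∣ x ∣ k)))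
    ; (suc i) → ℤ.≤-trans (D+k≥0 i) (ℤ.+-monoʳ-≤ (lookup D i) (+≤+ (ℕ.m≤n+m k ℤ.∣ x ∣)))
    }
    where
    0≤x+∣x∣ : ∀ x → + 0 ≤ x + + ℤ.∣ x ∣
    0≤x+∣x∣ (+ n)    = +≤+ z≤n
    0≤x+∣x∣ -[1+ n ] = ℤ.≤-reflexive (sym (ℤ.n⊖n≡0 (suc n)))

module ClusterFiring (a b : ℕ) .{{_ : NonZero b}} where

  module _ where
    open import Data.Nat.Base using (_+_; _*_; _≤_; _<_)

    loss-full : ∀ S → ∣ S ∣ ≡ b → loss a b S ≡ 1
    loss-full S ∣S∣≡b rewrite ∣S∣≡b | ℕ.n∸n≡0 b = cong suc (0/n≡0 b)

    loss-∁ : ∀ S → loss a b (∁ S) ≡ suc (gain a b S)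
    loss-∁ S rewrite ∣∁p∣≡n∸∣p∣ S | ℕ.m∸[m∸n]≡n (∣p∣≤n S) = refl

    loss+gain≡a : Coprime a b → ∀ S → 0 < ∣ S ∣ → ∣ S ∣ < b → loss a b S + gain a b S ≡ a
    loss+gain≡a coprime S 0<s s<b = begin
      suc ((b ∸ s) * a / b) + s * a / b ≡⟨ cong suc (ℕ.+-comm ((b ∸ s) * a / b) _) ⟩
      suc (s * a / b + (b ∸ s) * a / b) ≡⟨ m+n≡k*o⇒1+m/o+n/o≡k b∤s*a s*a+[b∸s]*a≡a*b ⟩
      a                                 ∎
      where
      open ≡-Reasoning
      s : ℕ
      s = ∣ S ∣
      b∤s*a : ¬ b ∣ s * a
      b∤s*a b∣s*a = ℕ.<⇒≱ s<b (∣⇒≤ {{ℕ.>-nonZero 0<s}}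
        (coprime-divisor (Coprime.sym coprime) (subst (b ∣_) (ℕ.*-comm s a) b∣s*a)))
      s*a+[b∸s]*a≡a*b : s * a + (b ∸ s) * a ≡ a * b
      s*a+[b∸s]*a≡a*b = begin
        s * a + (b ∸ s) * a ≡⟨ ℕ.*-distribʳ-+ a s (b ∸ s) ⟨
        (s + (b ∸ s)) * a   ≡⟨ cong (_* a) (ℕ.m+[n∸m]≡n (ℕ.<⇒≤ s<b)) ⟩
        b * a               ≡⟨ ℕ.*-comm b a ⟩
        a * b               ∎

    loss≤a : 0 < a → ∀ S → 0 < ∣ S ∣ → loss a b S ≤ a
    loss≤a 0<a S 0<s = m<n*o⇒m/o<n (begin-strict
      (b ∸ ∣ S ∣) * a ≡⟨ ℕ.*-comm (b ∸ ∣ S ∣) a ⟩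
      a * (b ∸ ∣ S ∣) <⟨ ℕ.*-monoʳ-< a (ℕ.∸-monoʳ-< 0<s (∣p∣≤n S)) ⟩
      a * b           ∎)
      where
      open ℕ.≤-Reasoning
      instance _ = ℕ.>-nonZero 0<a

    outside-gain<inside-loss : ∀ S → 0 < ∣ S ∣ → (b ∸ ∣ S ∣) * gain a b S < ∣ S ∣ * loss a b S
    outside-gain<inside-loss S = n*[m*a/b]<m*[1+n*a/b] ∣ S ∣ (b ∸ ∣ S ∣) a b

    fireable-part : Coprime a b → ∀ {c} → 0 < c → c < a → ∀ W →
      (Nonempty W × loss a b W + c ≤ a) ⊎ (Nonempty (∁ W) × loss a b (∁ W) ≤ c)
    fireable-part coprime {c} 0<c c<a W with ℕ.m≤n⇒m<n∨m≡n (∣p∣≤n W)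
    ... | inj₂ ∣W∣≡b = inj₁ (0<∣p∣⇒Nonempty (subst (0 <_) (sym ∣W∣≡b) (ℕ.>-nonZero⁻¹ b)) ,
                             subst (λ l → l + c ≤ a) (sym (loss-full W ∣W∣≡b)) c<a)
    ... | inj₁ ∣W∣<b with c ℕ.≤? gain a b W
    ...   | no c≰gain = inj₂ (0<∣p∣⇒Nonempty 0<∣∁W∣ , subst (_≤ c) (sym (loss-∁ W)) (ℕ.≰⇒> c≰gain))
      where
      0<∣∁W∣ : 0 < ∣ ∁ W ∣
      0<∣∁W∣ = subst (0 <_) (sym (∣∁p∣≡n∸∣p∣ W)) (ℕ.m<n⇒0<n∸m ∣W∣<b)
    ...   | yes c≤gain = inj₁ (0<∣p∣⇒Nonempty 0<∣W∣ , (begin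
      loss a b W + c          ≤⟨ ℕ.+-monoʳ-≤ (loss a b W) c≤gain ⟩
      loss a b W + gain a b W ≡⟨ loss+gain≡a coprime W 0<∣W∣ ∣W∣<b ⟩
      a                       ∎))
      where
      open ℕ.≤-Reasoning
      0<∣W∣ : 0 < ∣ W ∣
      0<∣W∣ = ℕ.n≢0⇒n>0 λ ∣W∣≡0 →
        ℕ.<⇒≱ 0<c (subst (c ≤_) (trans (cong (λ s → s * a / b) ∣W∣≡0) (0/n≡0 b)) c≤gain)

  module _ where
    open import Data.Integer.Base using (_+_; _-_; _*_; _≤_; _<_)
    open import Data.Integer.Tactic.RingSolver using (solve-∀)

    lookup-fire : ∀ S D i → lookup (fire a b S D) i ≡
      (if lookup S i then lookup D i - + loss a b S else lookup D i + + gain a b S)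
    lookup-fire S D = lookup∘tabulate _

    lookup-borrow : ∀ S D i → lookup (borrow a b S D) i ≡
      (if lookup S i then lookup D i + + loss a b S else lookup D i - + gain a b S)
    lookup-borrow S D = lookup∘tabulate _

    fire∘borrow : ∀ S D → fire a b S (borrow a b S D) ≡ D
    fire∘borrow S D = lookup-ext undo
      where
      add-sub : ∀ x y → x + y - y ≡ x
      add-sub = solve-∀
      sub-add : ∀ x y → x - y + y ≡ x
      sub-add = solve-∀
      undo : ∀ i → lookup (fire a b S (borrow a b S D)) i ≡ lookup D i
      undo i rewrite lookup-fire S (borrow a b S D) i | lookup-borrow S D i with lookup S i
      ... | true  = add-sub (lookup D i) (+ loss a b S)
      ... | false = sub-add (lookup D i) (+ gain a b S)

    lookup-fire-⊤ : ∀ D i → lookup (fire a b ⊤ D) i ≡ lookup D i - + 1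
    lookup-fire-⊤ D i rewrite lookup-fire ⊤ D i | lookup-replicate i true =
      cong (λ l → lookup D i - + l) (loss-full ⊤ (∣⊤∣≡n b))

    lookup-borrow-⊤ : ∀ D i → lookup (borrow a b ⊤ D) i ≡ lookup D i + + 1
    lookup-borrow-⊤ D i rewrite lookup-borrow ⊤ D i | lookup-replicate i true =
      cong (λ l → lookup D i + + l) (loss-full ⊤ (∣⊤∣≡n b))

    fire-≃ : Coprime a b → ∀ S D → D ≃ fire a b S D mod a
    fire-≃ coprime S D with ℕ.m≤n⇒m<n∨m≡n (∣p∣≤n S)
    ... | inj₂ ∣S∣≡b with refl ← ∣p∣≡n⇒p≡⊤ {p = S} ∣S∣≡b = -1ℤ , λ i → ≡⇒≡mod (lookup-fire-⊤ D i)
    ... | inj₁ ∣S∣<b = + gain a b S , shifted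
      where
      sub-loss : ∀ x L G → x - L ≡ x + G + -1ℤ * (L + G)
      sub-loss = solve-∀
      shifted : ∀ i → lookup (fire a b S D) i ≡ lookup D i + + gain a b S mod a
      shifted i rewrite lookup-fire S D i with lookup S i in i∈S
      ... | true  = -1ℤ ,
        subst (λ m → lookup D i - + loss a b S ≡ lookup D i + + gain a b S + -1ℤ * + m)
          (loss+gain≡a coprime S (Nonempty⇒0<∣p∣ (i , lookup⇒[]= i S i∈S)) ∣S∣<b)
          (sub-loss (lookup D i) (+ loss a b S) (+ gain a b S))
      ... | false = ≡⇒≡mod refl

    move⇒≃ : Coprime a b → ∀ {D D'} → Move a b D D' → D ≃ D' mod a
    move⇒≃ coprime {D} (S , inj₁ refl) = fire-≃ coprime S D
    move⇒≃ coprime {D} (S , inj₂ refl) = ≃-sym (subst (λ X → borrow a b S D ≃ X mod a)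
      (fire∘borrow S D) (fire-≃ coprime S (borrow a b S D)))

    ≈⇒≃ : Coprime a b → ∀ {D D'} → _≈_ a b D D' → D ≃ D' mod a
    ≈⇒≃ coprime = Star.fold (λ D D' → D ≃ D' mod a) (λ m → ≃-trans (move⇒≃ coprime m)) ≃-refl

    fire-nonneg : ∀ {S} D → NonNeg D → (∀ {i} → i ∈ S → + loss a b S ≤ lookup D i) →
      NonNeg (fire a b S D)
    fire-nonneg {S} D D≥0 enough i rewrite lookup-fire S D i with lookup S i in i∈S
    ... | true  = ℤ.i≤j⇒0≤j-i (enough (lookup⇒[]= i S i∈S))
    ... | false = ℤ.+-mono-≤ (D≥0 i) (+≤+ z≤n)

    superstable-entry<a : 0 ℕ.< a → ∀ E → Superstable a b E → ∀ i → lookup E i < + a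
    superstable-entry<a 0<a E (E≥0 , E-stuck) i = ℤ.≰⇒> λ a≤E[i] →
      E-stuck ⁅ i ⁆ (i , x∈⁅x⁆ i) (fire-nonneg E E≥0 λ j∈⁅i⁆ →
        subst (λ j → + loss a b ⁅ i ⁆ ≤ lookup E j) (sym (x∈⁅y⁆⇒x≡y i j∈⁅i⁆))
          (ℤ.≤-trans (+≤+ (loss≤a 0<a ⁅ i ⁆ (Nonempty⇒0<∣p∣ (i , x∈⁅x⁆ i)))) a≤E[i]))

    ¬superstable-shift : Coprime a b → ∀ {c} E E' → Superstable a b E → Superstable a b E' →
      0 ℕ.< c → c ℕ.< a → ¬ (∀ i → lookup E' i ≡ lookup E i + + c mod a)
    ¬superstable-shift coprime {c} E E' (E≥0 , E-stuck) ssE'@(E'≥0 , E'-stuck) 0<c c<a E'≡E+c =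
      [ W-fires , ∁W-fires ]′ (fireable-part coprime 0<c c<a W)
      where
      overflows? : Decidable λ j → + a ≤ lookup E j + + c
      overflows? j = + a ℤ.≤? lookup E j + + c

      W : Subset b
      W = select overflows?

      W-fires : Nonempty W × loss a b W ℕ.+ c ℕ.≤ a → ⊥
      W-fires (W≢∅ , loss+c≤a) = E-stuck W W≢∅ (fire-nonneg E E≥0 λ j∈W →
        +-cancelʳ-≤ (+ c) (ℤ.≤-trans (+≤+ loss+c≤a) (∈-select⁻ overflows? j∈W)))

      E'≡E+c-below : ∀ j → lookup E j + + c < + a → lookup E' j ≡ lookup E j + + c
      E'≡E+c-below j below = nonneg-≡mod⇒≡ (E'≥0 j) (superstable-entry<a (ℕ.<-trans 0<c c<a) E' ssE' j)
        (ℤ.+-mono-≤ (E≥0 j) (+≤+ z≤n)) below (E'≡E+c j)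

      ∁W-fires : Nonempty (∁ W) × loss a b (∁ W) ℕ.≤ c → ⊥
      ∁W-fires (∁W≢∅ , loss≤c) = E'-stuck (∁ W) ∁W≢∅ (fire-nonneg E' E'≥0 λ {j} j∈∁W →
        subst (+ loss a b (∁ W) ≤_) (sym (E'≡E+c-below j (ℤ.≰⇒> (∈-∁select⁻ overflows? j∈∁W))))
          (ℤ.≤-trans (+≤+ loss≤c) (ℤ.+-monoˡ-≤ (+ c) (E≥0 j))))

    ≃-superstable⇒≡ : 0 ℕ.< a → Coprime a b → ∀ {E E'} → Superstable a b E → Superstable a b E' →
      E ≃ E' mod a → E ≡ E'
    ≃-superstable⇒≡ 0<a coprime {E} {E'} ssE ssE' E≃E' with ≃⇒shift<a {{ℕ.>-nonZero 0<a}} E≃E'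
    ... | suc c , c<a , E'≡E+c =
      ⊥-elim (¬superstable-shift coprime E E' ssE ssE' (s≤s z≤n) c<a E'≡E+c)
    ... | zero  , _   , E'≡E+0 = lookup-ext λ i → sym (nonneg-≡mod⇒≡
      (proj₁ ssE' i) (superstable-entry<a 0<a E' ssE' i) (proj₁ ssE i) (superstable-entry<a 0<a E ssE i)
      (subst (λ x → lookup E' i ≡ x mod a) (ℤ.+-identityʳ (lookup E i)) (E'≡E+0 i)))

    ≈-superstable-unique : 0 ℕ.< a → Coprime a b → ∀ {D E E'} → _≈_ a b D E → _≈_ a b D E' →
      Superstable a b E → Superstable a b E' → E ≡ E'
    ≈-superstable-unique 0<a coprime D≈E D≈E' ssE ssE' =
      ≃-superstable⇒≡ 0<a coprime ssE ssE' (≃-trans (≃-sym (≈⇒≃ coprime D≈E)) (≈⇒≃ coprime D≈E'))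

    deg-fire : ∀ S D →
      deg (fire a b S D) + + (∣ S ∣ ℕ.* loss a b S) ≡ deg D + + ((b ∸ ∣ S ∣) ℕ.* gain a b S)
    deg-fire S D = begin
      deg (fire a b S D) + + (∣ S ∣ ℕ.* loss a b S)
        ≡⟨ cong (_+_ (deg (fire a b S D))) (ℤ.pos-* ∣ S ∣ _) ⟩
      deg (fire a b S D) + + ∣ S ∣ * + loss a b S
        ≡⟨ deg-transfer S _ _ D ⟩
      deg D + + ∣ ∁ S ∣ * + gain a b S
        ≡⟨ cong (λ s → deg D + + s * + gain a b S) (∣∁p∣≡n∸∣p∣ S) ⟩
      deg D + + (b ∸ ∣ S ∣) * + gain a b S
        ≡⟨ cong (_+_ (deg D)) (ℤ.pos-* (b ∸ ∣ S ∣) _) ⟨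
      deg D + + ((b ∸ ∣ S ∣) ℕ.* gain a b S) ∎
      where open ≡-Reasoning

    fire-decreases-deg : ∀ {S} D → Nonempty S → NonNeg D → NonNeg (fire a b S D) →
      ℤ.∣ deg (fire a b S D) ∣ ℕ.< ℤ.∣ deg D ∣
    fire-decreases-deg {S} D S≢∅ D≥0 fire≥0 = ℕ.+-cancelʳ-< lost F N (begin-strict
      F ℕ.+ lost   ≡⟨ ℤ.+-injective balance ⟩
      N ℕ.+ gained <⟨ ℕ.+-monoʳ-< N (outside-gain<inside-loss S (Nonempty⇒0<∣p∣ S≢∅)) ⟩
      N ℕ.+ lost   ∎)
      where
      open ℕ.≤-Reasoning
      F N lost gained : ℕ
      F      = ℤ.∣ deg (fire a b S D) ∣
      N      = ℤ.∣ deg D ∣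
      lost   = ∣ S ∣ ℕ.* loss a b S
      gained = (b ∸ ∣ S ∣) ℕ.* gain a b S
      balance : + F + + lost ≡ + N + + gained
      balance = subst₂ (λ x y → x + + lost ≡ y + + gained)
        (sym (ℤ.0≤i⇒+∣i∣≡i (deg-nonneg (fire a b S D) fire≥0))) (sym (ℤ.0≤i⇒+∣i∣≡i (deg-nonneg D D≥0)))
        (deg-fire S D)

    legal-fire? : ∀ D → Dec (∃ λ S → Nonempty S × NonNeg (fire a b S D))
    legal-fire? D = anySubset? λ S → nonempty? S ×-dec all? λ i → + 0 ℤ.≤? lookup (fire a b S D) i

    superstabilize : ∀ D → NonNeg D → ∃ (Superstabilization a b D)
    superstabilize D D≥0 = go D D≥0 (<-wellFounded ℤ.∣ deg D ∣)
      where
      go : ∀ D → NonNeg D → Acc ℕ._<_ ℤ.∣ deg D ∣ → ∃ (Superstabilization a b D)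
      go D D≥0 (acc smaller) with legal-fire? D
      ... | no ¬legal = D , ε , D≥0 , λ S S≢∅ legal → ¬legal (S , S≢∅ , legal)
      ... | yes (S , S≢∅ , legal)
        with go (fire a b S D) legal (smaller (fire-decreases-deg D S≢∅ D≥0 legal))
      ...   | E , steps , ssE = E , (D≥0 , S , S≢∅ , legal , refl) ◅ steps , ssE

    legal⇒≈ : ∀ {D E} → Star (LegalFire a b) D E → _≈_ a b D E
    legal⇒≈ = Star.map λ (_ , S , _ , _ , D'≡fire) → S , inj₁ D'≡fire

    ≈-shift : ∀ k D → ∃ λ D' → _≈_ a b D D' × ∀ i → lookup D' i ≡ lookup D i + + k
    ≈-shift zero    D = D , ε , λ i → sym (ℤ.+-identityʳ (lookup D i))
    ≈-shift (suc k) D with ≈-shift k (borrow a b ⊤ D)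
    ... | D' , D⁺≈D' , D'≡D⁺+k = D' , (⊤ , inj₂ refl) ◅ D⁺≈D' , λ i →
      trans (D'≡D⁺+k i) (trans (cong (λ x → x + + k) (lookup-borrow-⊤ D i))
        (ℤ.+-assoc (lookup D i) (+ 1) (+ k)))

    ≈-nonneg : ∀ D → ∃ λ D⁺ → _≈_ a b D D⁺ × NonNeg D⁺
    ≈-nonneg D with nonneg-offset D
    ... | k , D+k≥0 with ≈-shift k D
    ...   | D⁺ , D≈D⁺ , D⁺≡D+k = D⁺ , D≈D⁺ , λ i → subst (+ 0 ≤_) (sym (D⁺≡D+k i)) (D+k≥0 i)

    superstable-representative : 0 ℕ.< a → Coprime a b → ∀ D → ∃ λ E →
      Superstable a b E × _≈_ a b D E × (∀ E' → Superstable a b E' → _≈_ a b D E' → E' ≡ E)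
    superstable-representative 0<a coprime D with ≈-nonneg D
    ... | D⁺ , D≈D⁺ , D⁺≥0 with superstabilize D⁺ D⁺≥0
    ...   | E , D⁺⇝E , ssE = E , ssE , D≈E , λ E' ssE' D≈E' →
      ≈-superstable-unique 0<a coprime D≈E' D≈E ssE' ssE
      where
      D≈E : _≈_ a b D E
      D≈E = D≈D⁺ ◅◅ legal⇒≈ D⁺⇝E

    unique-superstabilization : 0 ℕ.< a → Coprime a b → ∀ D → NonNeg D → ∃ λ E →
      Superstabilization a b D E × (∀ E' → Superstabilization a b D E' → E' ≡ E)
    unique-superstabilization 0<a coprime D D≥0 with superstabilize D D≥0
    ... | E , D⇝E , ssE = E , (D⇝E , ssE) , λ E' (D⇝E' , ssE') →
      ≈-superstable-unique 0<a coprime (legal⇒≈ D⇝E') (legal⇒≈ D⇝E) ssE' ssE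

proposition5p5 : ∀ (a b : ℕ) → 0 ℕ.< a → .{{_ : NonZero b}} → Coprime a b →
    (∀ (D : Config b) → ∃ λ (E : Config b) →
      Superstable a b E × _≈_ a b D E ×
      (∀ (E' : Config b) → Superstable a b E' → _≈_ a b D E' → E' ≡ E))
  × (∀ (D : Config b) → NonNeg D → ∃ λ (E : Config b) →
      Superstabilization a b D E ×
      (∀ (E' : Config b) → Superstabilization a b D E' → E' ≡ E))
proposition5p5 a b 0<a coprime =
  superstable-representative 0<a coprime , unique-superstabilization 0<a coprime
  where open ClusterFiring a b
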